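{- Let $X=\mathbb{F}_2^n$, $Y=\mathbb{F}_2^r$, and let $\beta:X\to\mathbb{F}_2^{n\times r}$ be an injective map with $\beta(\mathbf{0})=O$ such that (P1) $\mathrm{rk}(\beta(\mathbf{a})-\beta(\mathbf{b}))=n-1$ for all distinct $\mathbf{a},\mathbf{b}\in X$, and (P2) for each $\mathbf{a}\in X$ the map sending $\mathbf{b}\in X\setminus\{\mathbf{a}\}$ to the (one-dimensional) kernel of $\beta(\mathbf{a})-\beta(\mathbf{b})$ is a bijection from $X\setminus\{\mathbf{a}\}$ onto the set of one-dimensional subspaces of $X$. Assume moreover that the subspaces $X(\mathbf{a})=\{(\mathbf{x},\mathbf{x}\beta(\mathbf{a})):\mathbf{x}\in X\}$, $\mathbf{a}\in X$, span $X\times Y\cong\mathbb{F}_2^{n+r}$. Let $\mathcal{D}=\{\beta(\mathbf{a}):\mathbf{a}\in X\}$. Then the kernel of $\mathscr{T}(\mathcal{D})$ is $\mathbb{F}_2$.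
   Context: Vectors are row vectors; the kernel of $M\in\mathbb{F}_2^{n\times r}$ is $\{\mathbf{x}:\mathbf{x}M=\mathbf{0}\}$. The set $\mathcal{D}$ is the DHO-set associated with the dimensional dual hyperoval $\{X(\mathbf{a}):\mathbf{a}\in X\}$ of rank $n$. For $\mathcal{D}\subseteq\mathbb{F}_2^{n\times r}$ put $S(\infty)=\{(\mathbf{0},\mathbf{y}):\mathbf{y}\in\mathbb{F}_2^r\}$ and $S(M)=\{(\mathbf{x},\mathbf{x}M):\mathbf{x}\in\mathbb{F}_2^n\}$ for $M\in\mathcal{D}$; the translation structure $\mathscr{T}(\mathcal{D})$ has point set $\mathbb{F}_2^n\times\mathbb{F}_2^r$ and lines the translates of these sets, and its kernel is the set of endomorphisms $\mu$ of $(\mathbb{F}_2^{n+r},+)$ with $S(M)^\mu\subseteq S(M)$ for all $M\in\mathcal{D}\cup\{\infty\}$. -}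

module Defs where

open import Data.Bool using (Bool; true; false; _xor_; _∧_)
open import Data.Bool.Properties using () renaming (_≟_ to _≟B_)
open import Data.Nat using (ℕ; zero; suc; _^_)
open import Data.List using (List; []; _∷_; map; length; deduplicate; concatMap; foldr)
open import Data.Vec using (Vec; []; _∷_; replicate; zipWith)
open import Data.Vec.Properties using (≡-dec)
open import Data.Product using (_×_; _,_; Σ; ∃; proj₁; proj₂)
open import Data.Sum using (_⊎_)
open import Relation.Binary.PropositionalEquality using (_≡_; _≢_)
open import Relation.Nullary using (¬_)

-- The field F₂ is Bool with _xor_ as addition and _∧_ as multiplication.
-- Row vectors of F₂ⁿ
F2^ : ℕ → Set
F2^ n = Vec Bool n

-- n × r matrices over F₂, given as the list of their n rows
Mat : ℕ → ℕ → Set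
Mat n r = Vec (F2^ r) n

zeroV : ∀ {n} → F2^ n
zeroV = replicate _ false

_+V_ : ∀ {n} → F2^ n → F2^ n → F2^ n
_+V_ = zipWith _xor_

zeroM : ∀ {n r} → Mat n r
zeroM = replicate _ zeroV

-- matrix difference (over F₂ equal to the sum)
_-M_ : ∀ {n r} → Mat n r → Mat n r → Mat n r
_-M_ = zipWith _+V_

_·M_ : ∀ {n r} → F2^ n → Mat n r → F2^ r
[] ·M [] = zeroV
(false ∷ x) ·M (row ∷ M) = x ·M M
(true ∷ x) ·M (row ∷ M) = row +V (x ·M M)

allVecs : (n : ℕ) → List (F2^ n)
allVecs zero = [] ∷ []
allVecs (suc n) = concatMap (λ v → (false ∷ v) ∷ (true ∷ v) ∷ []) (allVecs n)

rowSpaceSize : ∀ {n r} → Mat n r → ℕ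
rowSpaceSize {n} M = length (deduplicate (≡-dec _≟B_) (map (_·M M) (allVecs n)))

-- rank M = k  iff the row space of M (an F₂-subspace) has dimension k,
-- i.e. has exactly 2^k elements
HasRank : ∀ {n r} → Mat n r → ℕ → Set
HasRank M k = rowSpaceSize M ≡ 2 ^ k

InKer : ∀ {n r} → Mat n r → F2^ n → Set
InKer M x = x ·M M ≡ zeroV

-- the one-dimensional subspace ⟨v⟩ = {0, v} of F₂ⁿ (v ≠ 0)
InSpan1 : ∀ {n} → F2^ n → F2^ n → Set
InSpan1 v x = x ≡ zeroV ⊎ x ≡ v

_≐_ : ∀ {n} → (F2^ n → Set) → (F2^ n → Set) → Set
P ≐ Q = ∀ x → (P x → Q x) × (Q x → P x)

Injective : {A B : Set} → (A → B) → Set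
Injective f = ∀ a b → f a ≡ f b → a ≡ b

P1 : ∀ {n r} → (F2^ n → Mat n r) → Set
P1 {n} β = ∀ a b → a ≢ b → HasRank (β a -M β b) (n Data.Nat.∸ 1)

P2 : ∀ {n r} → (F2^ n → Mat n r) → Set
P2 {n} β = ∀ a →
    (∀ b → b ≢ a → Σ (F2^ n) λ v → v ≢ zeroV × (InKer (β a -M β b) ≐ InSpan1 v))
  ×
    (∀ b b′ → b ≢ a → b′ ≢ a → InKer (β a -M β b) ≐ InKer (β a -M β b′) → b ≡ b′)
  ×
    (∀ v → v ≢ zeroV → Σ (F2^ n) λ b → b ≢ a × (InKer (β a -M β b) ≐ InSpan1 v))

Pt : ℕ → ℕ → Set
Pt n r = F2^ n × F2^ r

_+P_ : ∀ {n r} → Pt n r → Pt n r → Pt n r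
(x , y) +P (x′ , y′) = (x +V x′) , (y +V y′)

zeroP : ∀ {n r} → Pt n r
zeroP = zeroV , zeroV

-- the subspaces X(a) = {(x, x β(a))} span X × Y: every point is a finite
-- sum of elements of ⋃ₐ X(a)
SpanCond : ∀ {n r} → (F2^ n → Mat n r) → Set
SpanCond {n} {r} β = ∀ (p : Pt n r) → Σ (List (F2^ n × F2^ n)) λ l →
  foldr (λ { (a , x) acc → (x , x ·M β a) +P acc }) zeroP l ≡ p

IsEndo : ∀ {n r} → (Pt n r → Pt n r) → Set
IsEndo μ = ∀ p q → μ (p +P q) ≡ μ p +P μ q

PreservesS : ∀ {n r} → (Pt n r → Pt n r) → Mat n r → Set
PreservesS {n} μ M = ∀ (x : F2^ n) → Σ (F2^ n) λ x′ → μ (x , x ·M M) ≡ (x′ , x′ ·M M)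

PreservesS∞ : ∀ {n r} → (Pt n r → Pt n r) → Set
PreservesS∞ {n} {r} μ = ∀ (y : F2^ r) → proj₁ (μ (zeroV , y)) ≡ zeroV

-- μ belongs to the kernel of the translation structure 𝒯(𝒟), 𝒟 = {β a : a ∈ X}
InTKernel : ∀ {n r} → (F2^ n → Mat n r) → (Pt n r → Pt n r) → Set
InTKernel {n} β μ = IsEndo μ × PreservesS∞ μ × (∀ (a : F2^ n) → PreservesS μ (β a))

-- An element μ of the kernel preserves S(O) = X × {0}, so it acts on X by an additive
-- map φ, and on every S(β a) as the graph map (x , x β a) ↦ (φ x , φ x β a).  By (P2)
-- every nonzero v spans the kernel of some β b, and comparing μ (v , 0) with
-- μ (v , v β b) shows that φ v lies in ker β b = ⟨v⟩.  An additive map fixing every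
-- line of F₂ⁿ is 0 or the identity, and since the S(β a) span X × Y the same holds for μ.
module Submission where

open import Defs
open import Data.Nat using (ℕ; zero; suc)
open import Data.Bool using (true; false)
open import Data.Bool.Properties using (xor-same; xor-assoc; xor-identityˡ; xor-identityʳ)
  renaming (_≟_ to _≟B_)
open import Data.Vec using ([]; _∷_)
open import Data.Vec.Properties using (≡-dec; zipWith-assoc; zipWith-identityˡ; zipWith-identityʳ)
open import Data.List using (List; []; _∷_; foldr)
open import Data.Product using (_×_; _,_; ∃; proj₁; proj₂)
open import Data.Sum using (_⊎_; inj₁; inj₂)
open import Function using (id)
open import Function.Bundles using (_⇔_; mk⇔)
open import Relation.Nullary using (¬_; Dec; yes; no; contradiction)
open import Relation.Binary.PropositionalEquality
  using (_≡_; refl; sym; trans; cong; cong₂; subst; module ≡-Reasoning)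

private variable
  n r : ℕ

+V-assoc : (x y z : F2^ n) → (x +V y) +V z ≡ x +V (y +V z)
+V-assoc = zipWith-assoc xor-assoc

+V-identityˡ : (x : F2^ n) → zeroV +V x ≡ x
+V-identityˡ = zipWith-identityˡ xor-identityˡ

+V-identityʳ : (x : F2^ n) → x +V zeroV ≡ x
+V-identityʳ = zipWith-identityʳ xor-identityʳ

+V-same : (x : F2^ n) → x +V x ≡ zeroV
+V-same []      = refl
+V-same (a ∷ x) = cong₂ _∷_ (xor-same a) (+V-same x)

+V-identityʳ-unique : (x y : F2^ n) → x +V y ≡ x → y ≡ zeroV
+V-identityʳ-unique x y x+y≡x = begin
  y                ≡⟨ sym (+V-identityˡ y) ⟩
  zeroV +V y       ≡⟨ cong (_+V y) (sym (+V-same x)) ⟩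
  (x +V x) +V y    ≡⟨ +V-assoc x x y ⟩
  x +V (x +V y)    ≡⟨ cong (x +V_) x+y≡x ⟩
  x +V x           ≡⟨ +V-same x ⟩
  zeroV            ∎
  where open ≡-Reasoning

+P-identityˡ : (p : Pt n r) → zeroP +P p ≡ p
+P-identityˡ (x , y) = cong₂ _,_ (+V-identityˡ x) (+V-identityˡ y)

+P-same : (p : Pt n r) → p +P p ≡ zeroP
+P-same (x , y) = cong₂ _,_ (+V-same x) (+V-same y)

·M-zeroˡ : (M : Mat n r) → zeroV ·M M ≡ zeroV
·M-zeroˡ []      = refl
·M-zeroˡ (_ ∷ M) = ·M-zeroˡ M

·M-zeroʳ : (x : F2^ n) → x ·M zeroM {n} {r} ≡ zeroV
·M-zeroʳ []          = refl
·M-zeroʳ (false ∷ x) = ·M-zeroʳ x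
·M-zeroʳ (true ∷ x)  = trans (+V-identityˡ _) (·M-zeroʳ x)

-M-identityˡ : (M : Mat n r) → zeroM -M M ≡ M
-M-identityˡ []        = refl
-M-identityˡ (row ∷ M) = cong₂ _∷_ (+V-identityˡ row) (-M-identityˡ M)

∀⊎∃¬ : {P : F2^ n → Set} → (∀ x → Dec (P x)) → (∀ x → P x) ⊎ ∃ λ x → ¬ P x
∀⊎∃¬ {zero} P? with P? []
... | yes p  = inj₁ λ { [] → p }
... | no ¬p  = inj₂ ([] , ¬p)
∀⊎∃¬ {suc n} P? with ∀⊎∃¬ (λ x → P? (false ∷ x)) | ∀⊎∃¬ (λ x → P? (true ∷ x))
... | inj₂ (x , ¬p) | _             = inj₂ (false ∷ x , ¬p)
... | inj₁ _        | inj₂ (x , ¬p) = inj₂ (true ∷ x , ¬p)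
... | inj₁ pf       | inj₁ pt       = inj₁ λ { (false ∷ x) → pf x ; (true ∷ x) → pt x }

Additive : (F2^ n → F2^ n) → Set
Additive φ = ∀ x y → φ (x +V y) ≡ φ x +V φ y

additive-line-preserving⇒trivial : (φ : F2^ n → F2^ n) → Additive φ →
  (∀ v → φ v ≡ zeroV ⊎ φ v ≡ v) → (∀ x → φ x ≡ zeroV) ⊎ (∀ x → φ x ≡ x)
additive-line-preserving⇒trivial φ φ-additive φ-lines
  with ∀⊎∃¬ (λ x → ≡-dec _≟B_ (φ x) zeroV)
... | inj₁ φ≡0       = inj₁ φ≡0
... | inj₂ (u , φu≢0) = inj₂ φ≡id
  where
  φu≡u : φ u ≡ u
  φu≡u with φ-lines u
  ... | inj₁ φu≡0 = contradiction φu≡0 φu≢0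
  ... | inj₂ φu≡u = φu≡u

  φ0≡0 : φ zeroV ≡ zeroV
  φ0≡0 with φ-lines zeroV
  ... | inj₁ φ0≡0 = φ0≡0
  ... | inj₂ φ0≡0 = φ0≡0

  -- for w ∈ ker φ the vector φ (u + w) = u ≠ 0 lies on ⟨u + w⟩, so u + w = u
  ker-φ-trivial : ∀ w → φ w ≡ zeroV → w ≡ zeroV
  ker-φ-trivial w φw≡0 = by-cases (φ-lines (u +V w))
    where
    φ[u+w]≡u : φ (u +V w) ≡ u
    φ[u+w]≡u = trans (φ-additive u w) (trans (cong₂ _+V_ φu≡u φw≡0) (+V-identityʳ u))

    by-cases : φ (u +V w) ≡ zeroV ⊎ φ (u +V w) ≡ u +V w → w ≡ zeroV
    by-cases (inj₁ φ[u+w]≡0)   =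
      contradiction (trans (cong φ (trans (sym φ[u+w]≡u) φ[u+w]≡0)) φ0≡0) φu≢0
    by-cases (inj₂ φ[u+w]≡u+w) = +V-identityʳ-unique u w (trans (sym φ[u+w]≡u+w) φ[u+w]≡u)

  φ≡id : ∀ w → φ w ≡ w
  φ≡id w with φ-lines w
  ... | inj₁ φw≡0 = trans φw≡0 (sym (ker-φ-trivial w φw≡0))
  ... | inj₂ φw≡w = φw≡w

restrictToX : (Pt n r → Pt n r) → F2^ n → F2^ n
restrictToX μ x = proj₁ (μ (x , zeroV))

module _ {μ : Pt n r → Pt n r} (μ-endo : IsEndo μ) where

  endo-zero : μ zeroP ≡ zeroP
  endo-zero = begin
    μ zeroP              ≡⟨ cong μ (sym (+P-same zeroP)) ⟩
    μ (zeroP +P zeroP)   ≡⟨ μ-endo zeroP zeroP ⟩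
    μ zeroP +P μ zeroP   ≡⟨ +P-same (μ zeroP) ⟩
    zeroP                ∎
    where open ≡-Reasoning

  restrictToX-additive : Additive (restrictToX μ)
  restrictToX-additive x y = cong proj₁ (begin
    μ (x +V y , zeroV)             ≡⟨ cong (λ z → μ (x +V y , z)) (sym (+V-same zeroV)) ⟩
    μ ((x , zeroV) +P (y , zeroV)) ≡⟨ μ-endo (x , zeroV) (y , zeroV) ⟩
    μ (x , zeroV) +P μ (y , zeroV) ∎)
    where open ≡-Reasoning

  preservesS⇒graph : PreservesS∞ μ → (M : Mat n r) → PreservesS μ M →
    ∀ x → μ (x , x ·M M) ≡ (restrictToX μ x , restrictToX μ x ·M M)
  preservesS⇒graph μ-S∞ M μ-SM x with μ-SM x
  ... | x′ , μ[x,xM]≡[x′,x′M] = subst (λ z → μ (x , x ·M M) ≡ (z , z ·M M)) x′≡φx μ[x,xM]≡[x′,x′M]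
    where
    open ≡-Reasoning
    φx = restrictToX μ x

    x′≡φx : x′ ≡ φx
    x′≡φx = begin
      x′                                         ≡⟨ cong proj₁ (sym μ[x,xM]≡[x′,x′M]) ⟩
      proj₁ (μ (x , x ·M M))                     ≡⟨ cong (λ p → proj₁ (μ p))
                                                      (cong₂ _,_ (sym (+V-identityʳ x)) (sym (+V-identityˡ _))) ⟩
      proj₁ (μ ((x , zeroV) +P (zeroV , x ·M M))) ≡⟨ cong proj₁ (μ-endo (x , zeroV) (zeroV , x ·M M)) ⟩
      φx +V proj₁ (μ (zeroV , x ·M M))           ≡⟨ cong (φx +V_) (μ-S∞ (x ·M M)) ⟩
      φx +V zeroV                                ≡⟨ +V-identityʳ φx ⟩
      φx                                         ∎

module _ {β : F2^ n → Mat n r} {μ : Pt n r → Pt n r} (μ∈K : InTKernel β μ) where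

  private
    μ-endo = proj₁ μ∈K
    μ-S∞   = proj₁ (proj₂ μ∈K)
    μ-S    = proj₂ (proj₂ μ∈K)
    φ      = restrictToX μ

  kernel-graph : ∀ a x → μ (x , x ·M β a) ≡ (φ x , φ x ·M β a)
  kernel-graph a = preservesS⇒graph μ-endo μ-S∞ (β a) (μ-S a)

  module _ (β0≡O : β zeroV ≡ zeroM) where

    kernel-fixes-X : ∀ x → proj₂ (μ (x , zeroV)) ≡ zeroV
    kernel-fixes-X x = begin
      proj₂ (μ (x , zeroV))     ≡⟨ cong (λ y → proj₂ (μ (x , y))) (sym (·M-zeroʳ x)) ⟩
      proj₂ (μ (x , x ·M zeroM)) ≡⟨ cong proj₂ (preservesS⇒graph μ-endo μ-S∞ zeroM μ-SO x) ⟩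
      φ x ·M zeroM              ≡⟨ ·M-zeroʳ (φ x) ⟩
      zeroV                     ∎
      where
      open ≡-Reasoning
      μ-SO : PreservesS μ zeroM
      μ-SO = subst (PreservesS μ) β0≡O (μ-S zeroV)

    kernel-preserves-lines : P2 β → ∀ v → φ v ≡ zeroV ⊎ φ v ≡ v
    kernel-preserves-lines p2 v with ≡-dec _≟B_ v zeroV
    ... | yes v≡0 = inj₁ (trans (cong φ v≡0) (cong proj₁ (endo-zero μ-endo)))
    ... | no  v≢0 with proj₂ (proj₂ (p2 zeroV)) v v≢0
    ...   | b , _ , ker≐⟨v⟩ = proj₁ (ker≐⟨v⟩ (φ v)) (subst (λ M → InKer M (φ v)) (sym ker-βb) φv∈kerβb)
      where
      open ≡-Reasoning
      ker-βb : β zeroV -M β b ≡ β b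
      ker-βb = trans (cong (_-M β b) β0≡O) (-M-identityˡ (β b))

      v∈kerβb : InKer (β b) v
      v∈kerβb = subst (λ M → InKer M v) ker-βb (proj₂ (ker≐⟨v⟩ v) (inj₂ refl))

      φv∈kerβb : InKer (β b) (φ v)
      φv∈kerβb = begin
        φ v ·M β b                ≡⟨ cong proj₂ (sym (kernel-graph b v)) ⟩
        proj₂ (μ (v , v ·M β b))  ≡⟨ cong (λ y → proj₂ (μ (v , y))) v∈kerβb ⟩
        proj₂ (μ (v , zeroV))     ≡⟨ kernel-fixes-X v ⟩
        zeroV                     ∎

generator : (F2^ n → Mat n r) → F2^ n × F2^ n → Pt n r
generator β (a , x) = x , x ·M β a

sumOfGenerators : (F2^ n → Mat n r) → List (F2^ n × F2^ n) → Pt n r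
sumOfGenerators β = foldr (λ g acc → generator β g +P acc) zeroP

endos-agree-on-span : {β : F2^ n → Mat n r} → SpanCond β →
  {μ ν : Pt n r → Pt n r} → IsEndo μ → IsEndo ν →
  (∀ a x → μ (x , x ·M β a) ≡ ν (x , x ·M β a)) → ∀ p → μ p ≡ ν p
endos-agree-on-span {β = β} span {μ} {ν} μ-endo ν-endo agree p =
  let (l , Σl≡p) = span p in subst (λ q → μ q ≡ ν q) Σl≡p (agree-on-sums l)
  where
  open ≡-Reasoning
  agree-on-sums : ∀ l → μ (sumOfGenerators β l) ≡ ν (sumOfGenerators β l)
  agree-on-sums []            = trans (endo-zero μ-endo) (sym (endo-zero ν-endo))
  agree-on-sums ((a , x) ∷ l) = begin
    μ (g +P s)    ≡⟨ μ-endo g s ⟩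
    μ g +P μ s    ≡⟨ cong₂ _+P_ (agree a x) (agree-on-sums l) ⟩
    ν g +P ν s    ≡⟨ sym (ν-endo g s) ⟩
    ν (g +P s)    ∎
    where
    g = generator β (a , x)
    s = sumOfGenerators β l

InTKernel-resp : {β : F2^ n → Mat n r} {μ ν : Pt n r → Pt n r} →
  (∀ p → μ p ≡ ν p) → InTKernel β μ → InTKernel β ν
InTKernel-resp {μ = μ} μ≗ν (μ-endo , μ-S∞ , μ-S) =
    (λ p q → trans (sym (μ≗ν (p +P q))) (trans (μ-endo p q) (cong₂ _+P_ (μ≗ν p) (μ≗ν q))))
  , (λ y → trans (cong proj₁ (sym (μ≗ν (zeroV , y)))) (μ-S∞ y))
  , (λ a x → let (x′ , eq) = μ-S a x in x′ , trans (sym (μ≗ν _)) eq)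

zero-endo : IsEndo (λ (_ : Pt n r) → zeroP)
zero-endo _ _ = sym (+P-same zeroP)

zero∈TKernel : {β : F2^ n → Mat n r} → InTKernel β (λ _ → zeroP)
zero∈TKernel {β = β} =
  zero-endo , (λ _ → refl) , (λ a _ → zeroV , cong (zeroV ,_) (sym (·M-zeroˡ (β a))))

id∈TKernel : {β : F2^ n → Mat n r} → InTKernel β id
id∈TKernel = (λ _ _ → refl) , (λ _ → refl) , (λ _ x → x , refl)

corollary6p2 : (n r : ℕ) (β : F2^ n → Mat n r) →
    Injective β → β zeroV ≡ zeroM → P1 β → P2 β → SpanCond β →
    (μ : Pt n r → Pt n r) →
    InTKernel β μ ⇔ ((∀ p → μ p ≡ zeroP) ⊎ (∀ p → μ p ≡ p))
corollary6p2 n r β _ β0≡O _ p2 span μ = mk⇔ kernel⇒trivial trivial⇒kernel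
  where
  kernel⇒trivial : InTKernel β μ → (∀ p → μ p ≡ zeroP) ⊎ (∀ p → μ p ≡ p)
  kernel⇒trivial μ∈K with additive-line-preserving⇒trivial (restrictToX μ)
                            (restrictToX-additive (proj₁ μ∈K)) (kernel-preserves-lines μ∈K β0≡O p2)
  ... | inj₁ φ≡0  = inj₁ (endos-agree-on-span span (proj₁ μ∈K) zero-endo λ a x →
          trans (kernel-graph μ∈K a x) (cong₂ _,_ (φ≡0 x) (trans (cong (_·M β a) (φ≡0 x)) (·M-zeroˡ (β a)))))
  ... | inj₂ φ≡id = inj₂ (endos-agree-on-span span (proj₁ μ∈K) (λ _ _ → refl) λ a x →
          trans (kernel-graph μ∈K a x) (cong (λ z → z , z ·M β a) (φ≡id x)))

  trivial⇒kernel : (∀ p → μ p ≡ zeroP) ⊎ (∀ p → μ p ≡ p) → InTKernel β μ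
  trivial⇒kernel (inj₁ μ≡0)  = InTKernel-resp (λ p → sym (μ≡0 p)) zero∈TKernel
  trivial⇒kernel (inj₂ μ≡id) = InTKernel-resp (λ p → sym (μ≡id p)) id∈TKernel
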